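{- Let $n\ge1$ and let $a=(a_1,a_2,a_3,a_4)$ be a vertex of $\Phi(\mathbb H(\mathbb Z_{2^n}))$ with $a_i=2^mu_i$ for all $i\in\{1,2,3,4\}$, where the $u_i$ are units of $\mathbb Z_{2^n}$. Then: (i) if $0<m<n$, $a$ is not adjacent to any vertex $b=(b_1,b_2,b_3,b_4)$ with $b_j=2^{n-m}v_j$ for all $j$, where the $v_j$ are units of $\mathbb Z_{2^n}$; (ii) if $0\le m<n$, $a$ is not adjacent to any vertex $c=(c_1,c_2,c_3,c_4)$ with $c_l=2^{n-(m+1)}w_l$ for all $l$, where the $w_l$ are units of $\mathbb Z_{2^n}$.
   Context: $\mathbb H(\mathbb Z_{2^n})$ is the ring of Hamilton quaternions over $\mathbb Z_{2^n}$. Its elements are $a_1+a_2i+a_3j+a_4k$ with $a_i\in\mathbb Z_{2^n}$, written $(a_1,a_2,a_3,a_4)$. Addition is coordinatewise, and multiplication is determined by distributivity, scalars commuting with $i,j,k$, and $i^2=j^2=k^2=-1$, $ij=-ji=k$, $jk=-kj=i$, $ki=-ik=j$. For a ring $R$ with unity, the non-zero divisor graph $\Phi(R)$ is the simple graph with vertex set $R\setminus\{0,1,-1\}$ in which two distinct vertices $x,y$ are adjacent if and only if $xy\neq0$ or $yx\neq0$. -}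

module Defs where

open import Data.Nat using (ℕ; zero; suc; _^_; _∸_; NonZero) renaming (_+_ to _+ℕ_; _*_ to _*ℕ_)
open import Data.Nat.Properties using (m^n≢0)
open import Data.Nat.DivMod using (_%_; m%n<n)
open import Data.Fin using (Fin; toℕ; fromℕ<)
open import Data.Product using (Σ; _×_)
open import Data.Sum using (_⊎_)
open import Relation.Binary.PropositionalEquality using (_≡_; _≢_)

record Zmod (n : ℕ) : Set where
  constructor mk
  field
    val : Fin (2 ^ n)
open Zmod public

private
  nz : (n : ℕ) → NonZero (2 ^ n)
  nz n = m^n≢0 2 n

embed : (n : ℕ) → ℕ → Zmod n
embed n k = mk (fromℕ< (m%n<n k (2 ^ n) {{nz n}}))

module _ {n : ℕ} where
  infixl 6 _+_ _-_
  infixl 7 _*_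

  _+_ : Zmod n → Zmod n → Zmod n
  x + y = embed n (toℕ (val x) +ℕ toℕ (val y))

  _*_ : Zmod n → Zmod n → Zmod n
  x * y = embed n (toℕ (val x) *ℕ toℕ (val y))

  -_ : Zmod n → Zmod n
  - x = embed n ((2 ^ n) ∸ toℕ (val x))

  _-_ : Zmod n → Zmod n → Zmod n
  x - y = x + (- y)

  0# 1# : Zmod n
  0# = embed n 0
  1# = embed n 1

  IsUnit : Zmod n → Set
  IsUnit u = Σ (Zmod n) (λ v → u * v ≡ 1#)

-- Hamilton quaternions over ℤ_{2^n}: a₁ + a₂ i + a₃ j + a₄ k
record ℍ (n : ℕ) : Set where
  constructor quat
  field
    c₁ c₂ c₃ c₄ : Zmod n
open ℍ public

module _ {n : ℕ} where
  infixl 7 _·_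

  _·_ : ℍ n → ℍ n → ℍ n
  quat a₁ a₂ a₃ a₄ · quat b₁ b₂ b₃ b₄ = quat
    (a₁ * b₁ - a₂ * b₂ - a₃ * b₃ - a₄ * b₄)
    (a₁ * b₂ + a₂ * b₁ + a₃ * b₄ - a₄ * b₃)
    (a₁ * b₃ - a₂ * b₄ + a₃ * b₁ + a₄ * b₂)
    (a₁ * b₄ + a₂ * b₃ - a₃ * b₂ + a₄ * b₁)

  0ℍ 1ℍ -1ℍ : ℍ n
  0ℍ = quat 0# 0# 0# 0#
  1ℍ = quat 1# 0# 0# 0#
  -1ℍ = quat (- 1#) 0# 0# 0#

  IsVertex : ℍ n → Set
  IsVertex x = x ≢ 0ℍ × x ≢ 1ℍ × x ≢ -1ℍ

  -- adjacency in the non-zero divisor graph (simple graph: distinct vertices)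
  Adjacent : ℍ n → ℍ n → Set
  Adjacent x y = IsVertex x × IsVertex y × x ≢ y × (x · y ≢ 0ℍ ⊎ y · x ≢ 0ℍ)

scaled : (n k : ℕ) → (u₁ u₂ u₃ u₄ : Zmod n) → ℍ n
scaled n k u₁ u₂ u₃ u₄ = quat (p * u₁) (p * u₂) (p * u₃) (p * u₄)
  where p = embed n (2 ^ k)

-- Each coordinate of a product of two scaled quaternions is a signed sum of
-- four products (2^k x)(2^l y) = 2^(k+l) x y.  If k + l = n these all vanish; if
-- k + l = n - 1 and x, y are units (hence odd) they all equal 2^(n-1).  In both
-- cases the common value z satisfies z + z = 0 and -z = z, so every signed sum
-- of four copies of z vanishes and the product is 0 in either order.
module Submission where

open import Defs
open import Data.Nat using (ℕ; suc; _≤_; _<_; _∸_; _^_; NonZero; >-nonZero⁻¹; s≤s)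
  renaming (_+_ to _⊕_; _*_ to _⊗_)
import Data.Nat.Properties as ℕ
open import Data.Nat.DivMod
  using (_%_; _/_; m%n<n; n%n≡0; m*n%n≡0; m<n⇒m%n≡m; %-distribˡ-+; %-distribˡ-*;
         [m+kn]%n≡m%n; m≡m%n+[m/n]*n; m∣n⇒o%n%m≡o%m)
open import Data.Nat.Divisibility using (divides)
open import Data.Nat.Solver using (module +-*-Solver)
open import Data.Fin using (toℕ)
open import Data.Fin.Properties using (toℕ-injective; toℕ-fromℕ<; toℕ<n)
open import Data.Product using (_×_; _,_)
open import Data.Sum using (inj₁; inj₂)
open import Relation.Nullary using (¬_)
open import Relation.Binary.PropositionalEquality
open ≡-Reasoning
open +-*-Solver using (solve; _:*_; _:+_; _:=_; con)

odd-factorˡ : ∀ a b → (a ⊗ b) % 2 ≡ 1 → a % 2 ≡ 1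
odd-factorˡ a b ab-odd =
  residue-odd (a % 2) (m%n<n a 2) (trans (sym (%-distribˡ-* a b 2)) ab-odd)
  where
  residue-odd : ∀ r → r < 2 → (r ⊗ (b % 2)) % 2 ≡ 1 → r ≡ 1
  residue-odd 0 _ ()
  residue-odd 1 _ _ = refl
  residue-odd (suc (suc r)) (s≤s (s≤s ())) _

odd-* : ∀ a b → a % 2 ≡ 1 → b % 2 ≡ 1 → (a ⊗ b) % 2 ≡ 1
odd-* a b a-odd b-odd =
  trans (%-distribˡ-* a b 2) (cong₂ (λ r s → (r ⊗ s) % 2) a-odd b-odd)

quat-cong : ∀ {n} {a₁ a₂ a₃ a₄ b₁ b₂ b₃ b₄ : Zmod n} →
  a₁ ≡ b₁ → a₂ ≡ b₂ → a₃ ≡ b₃ → a₄ ≡ b₄ → quat a₁ a₂ a₃ a₄ ≡ quat b₁ b₂ b₃ b₄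
quat-cong refl refl refl refl = refl

module _ {n : ℕ} where

  private instance
    2^n≢0 : NonZero (2 ^ n)
    2^n≢0 = ℕ.m^n≢0 2 n

  toℕ-embed : ∀ a → toℕ (val (embed n a)) ≡ a % 2 ^ n
  toℕ-embed a = toℕ-fromℕ< _

  embed-cong : ∀ {a b} → a % 2 ^ n ≡ b % 2 ^ n → embed n a ≡ embed n b
  embed-cong {a} {b} a≡b = cong mk (toℕ-injective (begin
    toℕ (val (embed n a)) ≡⟨ toℕ-embed a ⟩
    a % 2 ^ n             ≡⟨ a≡b ⟩
    b % 2 ^ n             ≡⟨ toℕ-embed b ⟨
    toℕ (val (embed n b)) ∎))

  embed-toℕ : (x : Zmod n) → embed n (toℕ (val x)) ≡ x
  embed-toℕ (mk i) = cong mk (toℕ-injective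
    (trans (toℕ-embed (toℕ i)) (m<n⇒m%n≡m (toℕ<n i))))

  embed-+ : ∀ a b → embed n a + embed n b ≡ embed n (a ⊕ b)
  embed-+ a b = embed-cong (begin
    (toℕ (val (embed n a)) ⊕ toℕ (val (embed n b))) % 2 ^ n
      ≡⟨ cong₂ (λ r s → (r ⊕ s) % 2 ^ n) (toℕ-embed a) (toℕ-embed b) ⟩
    (a % 2 ^ n ⊕ b % 2 ^ n) % 2 ^ n
      ≡⟨ %-distribˡ-+ a b (2 ^ n) ⟨
    (a ⊕ b) % 2 ^ n ∎)

  embed-* : ∀ a b → embed n a * embed n b ≡ embed n (a ⊗ b)
  embed-* a b = embed-cong (begin
    (toℕ (val (embed n a)) ⊗ toℕ (val (embed n b))) % 2 ^ n
      ≡⟨ cong₂ (λ r s → (r ⊗ s) % 2 ^ n) (toℕ-embed a) (toℕ-embed b) ⟩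
    ((a % 2 ^ n) ⊗ (b % 2 ^ n)) % 2 ^ n
      ≡⟨ %-distribˡ-* a b (2 ^ n) ⟨
    (a ⊗ b) % 2 ^ n ∎)

  toℕ-0# : toℕ (val (0# {n})) ≡ 0
  toℕ-0# = trans (toℕ-embed 0) (m<n⇒m%n≡m (>-nonZero⁻¹ (2 ^ n)))

  +-identityˡ : (x : Zmod n) → 0# + x ≡ x
  +-identityˡ x =
    trans (cong (λ r → embed n (r ⊕ toℕ (val x))) toℕ-0#) (embed-toℕ x)

  -0#≡0# : - 0# ≡ 0# {n}
  -0#≡0# = embed-cong (begin
    (2 ^ n ∸ toℕ (val (0# {n}))) % 2 ^ n ≡⟨ cong (λ r → (2 ^ n ∸ r) % 2 ^ n) toℕ-0# ⟩
    2 ^ n % 2 ^ n                        ≡⟨ n%n≡0 (2 ^ n) ⟩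
    0                                    ≡⟨ m<n⇒m%n≡m (>-nonZero⁻¹ (2 ^ n)) ⟨
    0 % 2 ^ n                            ∎)

  embed-2^n*≡0# : ∀ k → embed n (2 ^ n ⊗ k) ≡ 0#
  embed-2^n*≡0# k = embed-cong (begin
    (2 ^ n ⊗ k) % 2 ^ n ≡⟨ cong (_% 2 ^ n) (ℕ.*-comm (2 ^ n) k) ⟩
    (k ⊗ 2 ^ n) % 2 ^ n ≡⟨ m*n%n≡0 k (2 ^ n) ⟩
    0                   ≡⟨ m<n⇒m%n≡m (>-nonZero⁻¹ (2 ^ n)) ⟨
    0 % 2 ^ n           ∎)

  scaled-coordinate-product : ∀ k l (x y : Zmod n) →
    (embed n (2 ^ k) * x) * (embed n (2 ^ l) * y)
      ≡ embed n (2 ^ (k ⊕ l) ⊗ (toℕ (val x) ⊗ toℕ (val y)))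
  scaled-coordinate-product k l x y = begin
    (embed n (2 ^ k) * x) * (embed n (2 ^ l) * y)
      ≡⟨ cong₂ (λ x′ y′ → (embed n (2 ^ k) * x′) * (embed n (2 ^ l) * y′))
               (embed-toℕ x) (embed-toℕ y) ⟨
    (embed n (2 ^ k) * embed n a) * (embed n (2 ^ l) * embed n b)
      ≡⟨ cong₂ _*_ (embed-* (2 ^ k) a) (embed-* (2 ^ l) b) ⟩
    embed n (2 ^ k ⊗ a) * embed n (2 ^ l ⊗ b)
      ≡⟨ embed-* (2 ^ k ⊗ a) (2 ^ l ⊗ b) ⟩
    embed n ((2 ^ k ⊗ a) ⊗ (2 ^ l ⊗ b))
      ≡⟨ cong (embed n) (solve 4 (λ p q r s → (p :* r) :* (q :* s) := (p :* q) :* (r :* s))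
                               refl (2 ^ k) (2 ^ l) a b) ⟩
    embed n ((2 ^ k ⊗ 2 ^ l) ⊗ (a ⊗ b))
      ≡⟨ cong (λ e → embed n (e ⊗ (a ⊗ b))) (ℕ.^-distribˡ-+-* 2 k l) ⟨
    embed n (2 ^ (k ⊕ l) ⊗ (a ⊗ b)) ∎
    where
    a = toℕ (val x)
    b = toℕ (val y)

  quadruple≡0# : (z : Zmod n) → z + z ≡ 0# → z + z + z + z ≡ 0#
  quadruple≡0# z z+z≡0# = begin
    z + z + z + z ≡⟨ cong (λ w → w + z + z) z+z≡0# ⟩
    0# + z + z    ≡⟨ cong (_+ z) (+-identityˡ z) ⟩
    z + z         ≡⟨ z+z≡0# ⟩
    0#            ∎

  scaled·scaled≡0ℍ : ∀ k l (z : Zmod n) → z + z ≡ 0# → - z ≡ z →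
    (∀ x y → IsUnit x → IsUnit y → (embed n (2 ^ k) * x) * (embed n (2 ^ l) * y) ≡ z) →
    ∀ {u₁ u₂ u₃ u₄ v₁ v₂ v₃ v₄} →
    IsUnit u₁ → IsUnit u₂ → IsUnit u₃ → IsUnit u₄ →
    IsUnit v₁ → IsUnit v₂ → IsUnit v₃ → IsUnit v₄ →
    scaled n k u₁ u₂ u₃ u₄ · scaled n l v₁ v₂ v₃ v₄ ≡ 0ℍ
  scaled·scaled≡0ℍ k l z z+z≡0# -z≡z term≡z U₁ U₂ U₃ U₄ V₁ V₂ V₃ V₄ = quat-cong
    (trans (cong₂ _-_ (cong₂ _-_ (cong₂ _-_ (t U₁ V₁) (t U₂ V₂)) (t U₃ V₃)) (t U₄ V₄))
           (collapse (λ w → z + w + w + w) refl))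
    (trans (cong₂ _-_ (cong₂ _+_ (cong₂ _+_ (t U₁ V₂) (t U₂ V₁)) (t U₃ V₄)) (t U₄ V₃))
           (collapse (λ w → z + z + z + w) refl))
    (trans (cong₂ _+_ (cong₂ _+_ (cong₂ _-_ (t U₁ V₃) (t U₂ V₄)) (t U₃ V₁)) (t U₄ V₂))
           (collapse (λ w → z + w + z + z) refl))
    (trans (cong₂ _+_ (cong₂ _-_ (cong₂ _+_ (t U₁ V₄) (t U₂ V₃)) (t U₃ V₂)) (t U₄ V₁))
           (collapse (λ w → z + z + w + z) refl))
    where
    t : ∀ {x y} → IsUnit x → IsUnit y → (embed n (2 ^ k) * x) * (embed n (2 ^ l) * y) ≡ z
    t = term≡z _ _

    collapse : (f : Zmod n → Zmod n) → f z ≡ z + z + z + z → f (- z) ≡ 0#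
    collapse f f[z]≡4z = trans (cong f -z≡z) (trans f[z]≡4z (quadruple≡0# z z+z≡0#))

module _ {n : ℕ} where

  private
    instance
      2^suc-n≢0 : NonZero (2 ^ suc n)
      2^suc-n≢0 = ℕ.m^n≢0 2 (suc n)
      2^n≢0 : NonZero (2 ^ n)
      2^n≢0 = ℕ.m^n≢0 2 n
    h = 2 ^ n
    2^suc-n≡h+h : 2 ^ suc n ≡ h ⊕ h
    2^suc-n≡h+h = cong (h ⊕_) (ℕ.+-identityʳ h)
    h<2^suc-n : h < 2 ^ suc n
    h<2^suc-n = subst (h <_) (sym 2^suc-n≡h+h) (ℕ.m<m+n h (>-nonZero⁻¹ h))

  halfModulus : Zmod (suc n)
  halfModulus = embed (suc n) (2 ^ n)

  halfModulus+halfModulus≡0# : halfModulus + halfModulus ≡ 0#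
  halfModulus+halfModulus≡0# = begin
    halfModulus + halfModulus     ≡⟨ embed-+ h h ⟩
    embed (suc n) (h ⊕ h)         ≡⟨ cong (embed (suc n)) (trans (ℕ.*-identityʳ _) 2^suc-n≡h+h) ⟨
    embed (suc n) (2 ^ suc n ⊗ 1) ≡⟨ embed-2^n*≡0# 1 ⟩
    0#                            ∎

  -halfModulus≡halfModulus : - halfModulus ≡ halfModulus
  -halfModulus≡halfModulus = embed-cong (cong (_% 2 ^ suc n) (begin
    2 ^ suc n ∸ toℕ (val halfModulus) ≡⟨ cong (2 ^ suc n ∸_) (toℕ-embed {suc n} h) ⟩
    2 ^ suc n ∸ h % 2 ^ suc n         ≡⟨ cong (2 ^ suc n ∸_) (m<n⇒m%n≡m h<2^suc-n) ⟩
    2 ^ suc n ∸ h                     ≡⟨ cong (_∸ h) 2^suc-n≡h+h ⟩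
    h ⊕ h ∸ h                         ≡⟨ ℕ.m+n∸n≡m h h ⟩
    h                                 ∎))

  -- 2^n (1 + 2q) ≡ 2^n + q 2^(n+1).
  embed-2^n*odd : ∀ k → k % 2 ≡ 1 → embed (suc n) (h ⊗ k) ≡ halfModulus
  embed-2^n*odd k k-odd = embed-cong (begin
    (h ⊗ k) % 2 ^ suc n
      ≡⟨ cong (λ e → (h ⊗ e) % 2 ^ suc n) (m≡m%n+[m/n]*n k 2) ⟩
    (h ⊗ (k % 2 ⊕ (k / 2) ⊗ 2)) % 2 ^ suc n
      ≡⟨ cong (λ r → (h ⊗ (r ⊕ (k / 2) ⊗ 2)) % 2 ^ suc n) k-odd ⟩
    (h ⊗ (1 ⊕ (k / 2) ⊗ 2)) % 2 ^ suc n
      ≡⟨ cong (_% 2 ^ suc n)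
              (solve 2 (λ a q → a :* (con 1 :+ q :* con 2) := a :+ q :* (con 2 :* a)) refl h (k / 2)) ⟩
    (h ⊕ (k / 2) ⊗ 2 ^ suc n) % 2 ^ suc n
      ≡⟨ [m+kn]%n≡m%n h (k / 2) (2 ^ suc n) ⟩
    h % 2 ^ suc n ∎)

  unit-odd : (x : Zmod (suc n)) → IsUnit x → toℕ (val x) % 2 ≡ 1
  unit-odd x (y , x*y≡1) = odd-factorˡ a b (begin
    (a ⊗ b) % 2                ≡⟨ m∣n⇒o%n%m≡o%m 2 (2 ^ suc n) (a ⊗ b) (divides h (ℕ.*-comm 2 h)) ⟨
    (a ⊗ b) % 2 ^ suc n % 2    ≡⟨ cong (_% 2) (toℕ-embed {suc n} (a ⊗ b)) ⟨
    toℕ (val (x * y)) % 2      ≡⟨ cong (λ w → toℕ (val w) % 2) x*y≡1 ⟩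
    toℕ (val (1# {suc n})) % 2 ≡⟨ cong (_% 2) (toℕ-embed {suc n} 1) ⟩
    1 % 2 ^ suc n % 2          ≡⟨ cong (_% 2) (m<n⇒m%n≡m (ℕ.≤-<-trans (>-nonZero⁻¹ h) h<2^suc-n)) ⟩
    1                          ∎)
    where
    a = toℕ (val x)
    b = toℕ (val y)

¬Adjacent-if-annihilating : ∀ {n} {x y : ℍ n} → x · y ≡ 0ℍ → y · x ≡ 0ℍ → ¬ Adjacent x y
¬Adjacent-if-annihilating xy≡0 yx≡0 (_ , _ , _ , inj₁ xy≢0) = xy≢0 xy≡0
¬Adjacent-if-annihilating xy≡0 yx≡0 (_ , _ , _ , inj₂ yx≢0) = yx≢0 yx≡0

scaled·scaled≡0ℍ-complementary : ∀ {n} k l → k ⊕ l ≡ n → ∀ {u₁ u₂ u₃ u₄ v₁ v₂ v₃ v₄} →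
  IsUnit u₁ → IsUnit u₂ → IsUnit u₃ → IsUnit u₄ →
  IsUnit v₁ → IsUnit v₂ → IsUnit v₃ → IsUnit v₄ →
  scaled n k u₁ u₂ u₃ u₄ · scaled n l v₁ v₂ v₃ v₄ ≡ 0ℍ
scaled·scaled≡0ℍ-complementary {n} k l k+l≡n =
  scaled·scaled≡0ℍ k l 0# (+-identityˡ 0#) -0#≡0# λ x y _ _ →
    trans (scaled-coordinate-product k l x y)
          (subst (λ e → embed n (2 ^ e ⊗ (toℕ (val x) ⊗ toℕ (val y))) ≡ 0#) (sym k+l≡n)
                 (embed-2^n*≡0# _))

scaled·scaled≡0ℍ-nearly-complementary : ∀ {n} k l → k ⊕ l ≡ n →
  ∀ {u₁ u₂ u₃ u₄ v₁ v₂ v₃ v₄} →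
  IsUnit u₁ → IsUnit u₂ → IsUnit u₃ → IsUnit u₄ →
  IsUnit v₁ → IsUnit v₂ → IsUnit v₃ → IsUnit v₄ →
  scaled (suc n) k u₁ u₂ u₃ u₄ · scaled (suc n) l v₁ v₂ v₃ v₄ ≡ 0ℍ
scaled·scaled≡0ℍ-nearly-complementary {n} k l k+l≡n =
  scaled·scaled≡0ℍ k l halfModulus halfModulus+halfModulus≡0# -halfModulus≡halfModulus
    λ x y x-unit y-unit →
      trans (scaled-coordinate-product k l x y)
            (subst (λ e → embed (suc n) (2 ^ e ⊗ (toℕ (val x) ⊗ toℕ (val y))) ≡ halfModulus)
                   (sym k+l≡n)
                   (embed-2^n*odd _ (odd-* (toℕ (val x)) (toℕ (val y))
                                           (unit-odd x x-unit) (unit-odd y y-unit))))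

proposition4p2 : (n : ℕ) → 1 ≤ n → (m : ℕ) → (u₁ u₂ u₃ u₄ : Zmod n) →
    IsUnit u₁ → IsUnit u₂ → IsUnit u₃ → IsUnit u₄ →
    IsVertex (scaled n m u₁ u₂ u₃ u₄) →
    ((0 < m → m < n → (v₁ v₂ v₃ v₄ : Zmod n) →
        IsUnit v₁ → IsUnit v₂ → IsUnit v₃ → IsUnit v₄ →
        IsVertex (scaled n (n ∸ m) v₁ v₂ v₃ v₄) →
        ¬ Adjacent (scaled n m u₁ u₂ u₃ u₄) (scaled n (n ∸ m) v₁ v₂ v₃ v₄))
    × (m < n → (w₁ w₂ w₃ w₄ : Zmod n) →
        IsUnit w₁ → IsUnit w₂ → IsUnit w₃ → IsUnit w₄ →
        IsVertex (scaled n (n ∸ suc m) w₁ w₂ w₃ w₄) →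
        ¬ Adjacent (scaled n m u₁ u₂ u₃ u₄) (scaled n (n ∸ suc m) w₁ w₂ w₃ w₄)))
proposition4p2 (suc n) _ m u₁ u₂ u₃ u₄ U₁ U₂ U₃ U₄ _ =
  (λ _ m<n v₁ v₂ v₃ v₄ V₁ V₂ V₃ V₄ _ → ¬Adjacent-if-annihilating
     (scaled·scaled≡0ℍ-complementary m (suc n ∸ m) (ℕ.m+[n∸m]≡n (ℕ.<⇒≤ m<n))
        U₁ U₂ U₃ U₄ V₁ V₂ V₃ V₄)
     (scaled·scaled≡0ℍ-complementary (suc n ∸ m) m (ℕ.m∸n+n≡m (ℕ.<⇒≤ m<n))
        V₁ V₂ V₃ V₄ U₁ U₂ U₃ U₄))
  ,
  (λ m<n w₁ w₂ w₃ w₄ W₁ W₂ W₃ W₄ _ → ¬Adjacent-if-annihilating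
     (scaled·scaled≡0ℍ-nearly-complementary m (n ∸ m) (ℕ.m+[n∸m]≡n (ℕ.≤-pred m<n))
        U₁ U₂ U₃ U₄ W₁ W₂ W₃ W₄)
     (scaled·scaled≡0ℍ-nearly-complementary (n ∸ m) m (ℕ.m∸n+n≡m (ℕ.≤-pred m<n))
        W₁ W₂ W₃ W₄ U₁ U₂ U₃ U₄))
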